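{- Let $\mathcal{R}'=\{\beta,\mu,\mu',\rho,\varepsilon\}$, let $M\in\mathcal{T}_t$ and let $\alpha$ be a $\mu$-variable. If $M\in\mathcal{NF}_{\mathcal{R}'}$, then $M_\alpha\in\mathcal{NF}_{\mathcal{R}'}$. Moreover: (1) if $M_\alpha$ starts with $\mu$, then $M$ starts with $\mu$; (2) if $M_\alpha$ starts with $\lambda$, then $M$ starts with $\lambda$ or with $[\cdot]$.
   Context: $\lambda\mu$-terms: $\mathcal{T} ::= x \mid \lambda x.\mathcal{T} \mid (\mathcal{T})\mathcal{T} \mid [\alpha]\mathcal{T} \mid \mu\alpha.\mathcal{T}$, up to renaming of bound variables. A term starts with $\lambda$ (resp. $\mu$, $[\cdot]$) if it is of the form $\lambda x.P$ (resp. $\mu\beta.P$, $[\beta]P$). Types $A ::= X \mid \bot \mid A\to B$; typing judgments $\Gamma\vdash M:A;\Theta$ by: $\Gamma,x:A\vdash x:A;\Theta$; from $\Gamma,x:A\vdash M:B;\Theta$ infer $\Gamma\vdash\lambda x.M:A\to B;\Theta$; from $\Gamma\vdash M:A\to B;\Theta$, $\Gamma\vdash N:A;\Theta$ infer $\Gamma\vdash(M)N:B;\Theta$; from $\Gamma\vdash M:A;\alpha:A,\Theta$ infer $\Gamma\vdash[\alpha]M:\bot;\alpha:A,\Theta$; from $\Gamma\vdash M:\bot;\alpha:A,\Theta$ infer $\Gamma\vdash\mu\alpha.M:A;\Theta$. $\mathcal{T}_t$ = typable terms. $M_\alpha$: $x_\alpha=x$, $(\lambda x.M)_\alpha=\lambda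 x.M_\alpha$, $((P)Q)_\alpha=(P_\alpha)Q_\alpha$, $(\mu\beta.M)_\alpha=\mu\beta.M_\alpha$, $([\beta]M)_\alpha=[\beta]M_\alpha$ for $\beta\neq\alpha$, $([\alpha]M)_\alpha=M_\alpha$. $\mathcal{NF}_{\mathcal{R}'}$ is the set of terms containing no subterm of the forms $(\lambda x.M)N$, $(\mu\alpha.M)N$, $(N)\mu\alpha.M$, $[\beta]\mu\alpha.M$, or $\mu\alpha.\mu\beta.M$. -}

module Defs where

open import Data.Nat using (ℕ; _≟_)
open import Data.Product using (Σ; ∃; _×_; _,_)
open import Data.Sum using (_⊎_)
open import Relation.Nullary using (¬_; yes; no)
open import Relation.Binary.PropositionalEquality using (_≡_)

-- λ-variables and μ-variables are drawn from two disjoint copies of ℕ.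
LVar : Set
LVar = ℕ

MVar : Set
MVar = ℕ

data Term : Set where
  var  : LVar → Term
  lam  : LVar → Term → Term
  app  : Term → Term → Term
  name : MVar → Term → Term          -- [α]M
  mu   : MVar → Term → Term

data Ty : Set where
  tvar : ℕ → Ty
  bot  : Ty
  _⇒_  : Ty → Ty → Ty

Ctx : Set
Ctx = ℕ → Ty

_[_↦_] : Ctx → ℕ → Ty → Ctx
(Γ [ x ↦ A ]) y with y ≟ x
... | yes _ = A
... | no  _ = Γ y

data _⊢_∶_∣_ : Ctx → Term → Ty → Ctx → Set where
  ty-var  : ∀ {Γ Θ x A} → Γ x ≡ A → Γ ⊢ var x ∶ A ∣ Θ
  ty-lam  : ∀ {Γ Θ x A B M} → (Γ [ x ↦ A ]) ⊢ M ∶ B ∣ Θ → Γ ⊢ lam x M ∶ (A ⇒ B) ∣ Θ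
  ty-app  : ∀ {Γ Θ A B M N} → Γ ⊢ M ∶ (A ⇒ B) ∣ Θ → Γ ⊢ N ∶ A ∣ Θ → Γ ⊢ app M N ∶ B ∣ Θ
  ty-name : ∀ {Γ Θ α A M} → Θ α ≡ A → Γ ⊢ M ∶ A ∣ Θ → Γ ⊢ name α M ∶ bot ∣ Θ
  ty-mu   : ∀ {Γ Θ α A M} → Γ ⊢ M ∶ bot ∣ (Θ [ α ↦ A ]) → Γ ⊢ mu α M ∶ A ∣ Θ

Typable : Term → Set
Typable M = Σ Ctx λ Γ → Σ Ty λ A → Σ Ctx λ Θ → Γ ⊢ M ∶ A ∣ Θ

-- M_α : erase the occurrences of [α] (free α only; a binder μα shadows α,
-- which agrees with the convention that bound names are renamed apart from α)
erase : MVar → Term → Term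
erase α (var x) = var x
erase α (lam x M) = lam x (erase α M)
erase α (app P Q) = app (erase α P) (erase α Q)
erase α (mu β M) with β ≟ α
... | yes _ = mu β M
... | no  _ = mu β (erase α M)
erase α (name β M) with β ≟ α
... | yes _ = erase α M
... | no  _ = name β (erase α M)

StartsLam : Term → Set
StartsLam M = ∃ λ x → ∃ λ P → M ≡ lam x P

StartsMu : Term → Set
StartsMu M = ∃ λ β → ∃ λ P → M ≡ mu β P

StartsName : Term → Set
StartsName M = ∃ λ β → ∃ λ P → M ≡ name β P

data _⊑_ : Term → Term → Set where
  here  : ∀ {M} → M ⊑ M
  inLam : ∀ {N x M} → N ⊑ M → N ⊑ lam x M
  inAppˡ : ∀ {N M P} → N ⊑ M → N ⊑ app M P
  inAppʳ : ∀ {N M P} → N ⊑ P → N ⊑ app M P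
  inName : ∀ {N β M} → N ⊑ M → N ⊑ name β M
  inMu  : ∀ {N β M} → N ⊑ M → N ⊑ mu β M

data Redex : Term → Set where
  r-β   : ∀ {x M N} → Redex (app (lam x M) N)
  r-μ   : ∀ {α M N} → Redex (app (mu α M) N)
  r-μ'  : ∀ {α M N} → Redex (app N (mu α M))
  r-ρ   : ∀ {β α M} → Redex (name β (mu α M))
  r-ε   : ∀ {α β M} → Redex (mu α (mu β M))

NF : Term → Set
NF M = ∀ N → N ⊑ M → ¬ Redex N

-- Erasing [α] can only create a redex where some [α]N was replaced by N_α.
-- For the rules μ, μ', ρ, ε, N_α would start with μ, hence (inductively) so
-- would N, and [α]N would already be a ρ-redex of M. For rule β, N_α would
-- start with λ, so [α]N would be the head of an application; but a head has
-- an arrow type, while [α]N has type ⊥.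
module Submission where

open import Defs
open import Data.Product using (_×_; _,_)
open import Data.Sum using (_⊎_; inj₁; inj₂)
open import Data.Empty using (⊥-elim)
open import Data.Nat using (_≟_)
open import Relation.Nullary using (¬_; yes; no)
open import Relation.Binary.PropositionalEquality using (refl)

⊑-trans : ∀ {L M N} → L ⊑ M → M ⊑ N → L ⊑ N
⊑-trans p here       = p
⊑-trans p (inLam q)  = inLam (⊑-trans p q)
⊑-trans p (inAppˡ q) = inAppˡ (⊑-trans p q)
⊑-trans p (inAppʳ q) = inAppʳ (⊑-trans p q)
⊑-trans p (inName q) = inName (⊑-trans p q)
⊑-trans p (inMu q)   = inMu (⊑-trans p q)

NF-⊑ : ∀ {M N} → M ⊑ N → NF N → NF M
NF-⊑ p nf L q = nf L (⊑-trans q p)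

NF-lam : ∀ {x P} → NF P → NF (lam x P)
NF-lam nf _ here ()
NF-lam nf N (inLam s) = nf N s

NF-app : ∀ {P Q} → ¬ Redex (app P Q) → NF P → NF Q → NF (app P Q)
NF-app root nfP nfQ _ here       = root
NF-app root nfP nfQ N (inAppˡ s) = nfP N s
NF-app root nfP nfQ N (inAppʳ s) = nfQ N s

NF-name : ∀ {β P} → ¬ Redex (name β P) → NF P → NF (name β P)
NF-name root nf _ here       = root
NF-name root nf N (inName s) = nf N s

NF-mu : ∀ {β P} → ¬ Redex (mu β P) → NF P → NF (mu β P)
NF-mu root nf _ here     = root
NF-mu root nf N (inMu s) = nf N s

Redex-app-cases : ∀ {P Q} → Redex (app P Q) → StartsLam P ⊎ StartsMu P ⊎ StartsMu Q
Redex-app-cases (r-β {x} {M})  = inj₁ (x , M , refl)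
Redex-app-cases (r-μ {α} {M})  = inj₂ (inj₁ (α , M , refl))
Redex-app-cases (r-μ' {α} {M}) = inj₂ (inj₂ (α , M , refl))

Redex-name⇒StartsMu : ∀ {β P} → Redex (name β P) → StartsMu P
Redex-name⇒StartsMu (r-ρ {_} {α} {M}) = α , M , refl

Redex-mu⇒StartsMu : ∀ {β P} → Redex (mu β P) → StartsMu P
Redex-mu⇒StartsMu (r-ε {_} {β} {M}) = β , M , refl

NF-app⇒¬StartsLam-head : ∀ {P Q} → NF (app P Q) → ¬ StartsLam P
NF-app⇒¬StartsLam-head nf (_ , _ , refl) = nf _ here r-β

NF-app⇒¬StartsMu-head : ∀ {P Q} → NF (app P Q) → ¬ StartsMu P
NF-app⇒¬StartsMu-head nf (_ , _ , refl) = nf _ here r-μ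

NF-app⇒¬StartsMu-arg : ∀ {P Q} → NF (app P Q) → ¬ StartsMu Q
NF-app⇒¬StartsMu-arg nf (_ , _ , refl) = nf _ here r-μ'

NF-name⇒¬StartsMu : ∀ {β P} → NF (name β P) → ¬ StartsMu P
NF-name⇒¬StartsMu nf (_ , _ , refl) = nf _ here r-ρ

NF-mu⇒¬StartsMu : ∀ {β P} → NF (mu β P) → ¬ StartsMu P
NF-mu⇒¬StartsMu nf (_ , _ , refl) = nf _ here r-ε

⇒-typed⇒¬StartsName : ∀ {Γ Θ A B M} → Γ ⊢ M ∶ A ⇒ B ∣ Θ → ¬ StartsName M
⇒-typed⇒¬StartsName () (_ , _ , refl)

erase-StartsLam : ∀ α M → StartsLam (erase α M) → StartsLam M ⊎ StartsName M
erase-StartsLam α (var x)    (_ , _ , ())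
erase-StartsLam α (lam x M)  _ = inj₁ (x , M , refl)
erase-StartsLam α (app P Q)  (_ , _ , ())
erase-StartsLam α (name β M) _ = inj₂ (β , M , refl)
erase-StartsLam α (mu β M)   (_ , _ , _) with β ≟ α
erase-StartsLam α (mu β M) (_ , _ , ()) | yes _
erase-StartsLam α (mu β M) (_ , _ , ()) | no _

erase-StartsMu : ∀ α M → NF M → StartsMu (erase α M) → StartsMu M
erase-StartsMu α (var x)   nf (_ , _ , ())
erase-StartsMu α (lam x M) nf (_ , _ , ())
erase-StartsMu α (app P Q) nf (_ , _ , ())
erase-StartsMu α (mu β M)  nf _ = β , M , refl
erase-StartsMu α (name β M) nf s with β ≟ α
erase-StartsMu α (name β M) nf s | yes _ =
  ⊥-elim (NF-name⇒¬StartsMu nf (erase-StartsMu α M (NF-⊑ (inName here) nf) s))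
erase-StartsMu α (name β M) nf (_ , _ , ()) | no _

erase-app-¬Redex : ∀ {Γ Θ A B α P Q} → Γ ⊢ P ∶ A ⇒ B ∣ Θ → NF (app P Q) →
  ¬ Redex (app (erase α P) (erase α Q))
erase-app-¬Redex {α = α} {P} {Q} dP nf r with Redex-app-cases r
... | inj₁ lamHead with erase-StartsLam α P lamHead
...   | inj₁ lamP  = NF-app⇒¬StartsLam-head nf lamP
...   | inj₂ nameP = ⇒-typed⇒¬StartsName dP nameP
erase-app-¬Redex {α = α} {P} {Q} dP nf r | inj₂ (inj₁ muHead) =
  NF-app⇒¬StartsMu-head nf (erase-StartsMu α P (NF-⊑ (inAppˡ here) nf) muHead)
erase-app-¬Redex {α = α} {P} {Q} dP nf r | inj₂ (inj₂ muArg) =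
  NF-app⇒¬StartsMu-arg nf (erase-StartsMu α Q (NF-⊑ (inAppʳ here) nf) muArg)

erase-NF : ∀ {Γ Θ A M} α → Γ ⊢ M ∶ A ∣ Θ → NF M → NF (erase α M)
erase-NF α (ty-var _) nf = nf
erase-NF α (ty-lam d) nf = NF-lam (erase-NF α d (NF-⊑ (inLam here) nf))
erase-NF α (ty-app dP dQ) nf =
  NF-app (erase-app-¬Redex dP nf)
         (erase-NF α dP (NF-⊑ (inAppˡ here) nf))
         (erase-NF α dQ (NF-⊑ (inAppʳ here) nf))
erase-NF α (ty-name {α = β} {M = M} _ d) nf with β ≟ α
... | yes _ = erase-NF α d (NF-⊑ (inName here) nf)
... | no _  =
  NF-name (λ r → NF-name⇒¬StartsMu nf
                   (erase-StartsMu α M nfM (Redex-name⇒StartsMu r)))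
          (erase-NF α d nfM)
  where nfM = NF-⊑ (inName here) nf
erase-NF α (ty-mu {α = β} {M = M} d) nf with β ≟ α
... | yes _ = nf
... | no _  =
  NF-mu (λ r → NF-mu⇒¬StartsMu nf
                 (erase-StartsMu α M nfM (Redex-mu⇒StartsMu r)))
        (erase-NF α d nfM)
  where nfM = NF-⊑ (inMu here) nf

lemma5p6 : (M : Term) → Typable M → (α : MVar) → NF M →
    NF (erase α M)
    × (StartsMu (erase α M) → StartsMu M)
    × (StartsLam (erase α M) → StartsLam M ⊎ StartsName M)
lemma5p6 M (_ , _ , _ , d) α nf =
  erase-NF α d nf , erase-StartsMu α M nf , erase-StartsLam α M
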